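{- Let $\ell\ge 1$ and let $S=(1^\ell,2^\infty)$, i.e. the infinite sequence whose first $\ell$ terms equal $1$ and all further terms equal $2$. Let $A=\{1,a_1,\ldots,a_k\}$, $k\ge 1$, be a set of positive integers. Then there exists a $\chi_S$-critical graph $G$ such that $\Delta_{\chi_S}(G)=A$, where $\Delta_{\chi_S}(G)=\{\chi_S(G)-\chi_S(G-u):\ u\in V(G)\}$.
   Context: For a non-decreasing sequence $S=(s_1,s_2,\ldots)$ of positive integers, an $S$-packing $k$-coloring of a graph $G$ is a map $c:V(G)\to\{1,\ldots,k\}$ such that whenever $u\neq v$ and $c(u)=c(v)=i$, the shortest-path distance satisfies $d_G(u,v)>s_i$. The $S$-packing chromatic number $\chi_S(G)$ is the least $k$ such that $G$ admits an $S$-packing $k$-coloring. A graph $G$ is $\chi_S$-critical if $\chi_S(G-u)<\chi_S(G)$ for every $u\in V(G)$. -}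

module Defs where

open import Data.Nat using (ℕ; zero; suc; _<_; _≤_; _∸_; pred; _≤ᵇ_)
open import Data.Fin using (Fin; toℕ; punchIn)
open import Data.Bool using (Bool; true; false; if_then_else_)
open import Data.Product using (_×_; Σ; ∃)
open import Data.List using (List)
open import Relation.Binary.PropositionalEquality using (_≡_; _≢_)

record Graph (n : ℕ) : Set where
  field
    adj    : Fin n → Fin n → Bool
    sym    : ∀ u v → adj u v ≡ adj v u
    irrefl : ∀ u → adj u u ≡ false
open Graph public

data Walk {n : ℕ} (G : Graph n) : Fin n → Fin n → ℕ → Set where
  here : ∀ {u} → Walk G u u 0
  step : ∀ {u w v l} → adj G u w ≡ true → Walk G w v l → Walk G u v (suc l)

-- d_G(u,v) > s : every walk from u to v has length > s
-- (the shortest-path distance is the minimal walk length; ∞ if none).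
DistGt : ∀ {n} → Graph n → Fin n → Fin n → ℕ → Set
DistGt G u v s = ∀ l → Walk G u v l → s < l

-- S-packing k-colouring, for a sequence s indexed from 1 (s 1, s 2, ...).
-- Colour c : Fin k stands for the colour i = toℕ c + 1.
IsSPackingColoring : ∀ {n} → (ℕ → ℕ) → Graph n → (k : ℕ) → (Fin n → Fin k) → Set
IsSPackingColoring s G k c =
  ∀ u v → u ≢ v → c u ≡ c v → DistGt G u v (s (suc (toℕ (c u))))

HasSPackingColoring : ∀ {n} → (ℕ → ℕ) → Graph n → ℕ → Set
HasSPackingColoring {n} s G k = Σ (Fin n → Fin k) (IsSPackingColoring s G k)

IsChiS : ∀ {n} → (ℕ → ℕ) → Graph n → ℕ → Set
IsChiS s G k = HasSPackingColoring s G k × (∀ j → HasSPackingColoring s G j → k ≤ j)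

deleteVertex : ∀ {n} → Graph n → Fin n → Graph (pred n)
deleteVertex {suc m} G u = record
  { adj    = λ i j → adj G (punchIn u i) (punchIn u j)
  ; sym    = λ i j → sym G (punchIn u i) (punchIn u j)
  ; irrefl = λ i → irrefl G (punchIn u i)
  }

IsChiSCritical : ∀ {n} → (ℕ → ℕ) → Graph n → Set
IsChiSCritical s G = ∀ u k k' → IsChiS s G k → IsChiS s (deleteVertex G u) k' → k' < k

InDelta : ∀ {n} → (ℕ → ℕ) → Graph n → ℕ → Set
InDelta {n} s G d = Σ (Fin n) λ u → ∃ λ k → ∃ λ k' →
  IsChiS s G k × IsChiS s (deleteVertex G u) k' × d ≡ k ∸ k'

seq1ℓ2∞ : ℕ → ℕ → ℕ
seq1ℓ2∞ ℓ i = if i ≤ᵇ ℓ then 1 else 2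

-- The graph consists of two cliques: X, made of enough base vertices and one hub h_j for each entry x_j
-- of the list a ∷ a ∷ as, and Y, made of ℓ + 1 pads and, for each j, x_j − 1 spokes of h_j. Between
-- X and Y, each hub is adjacent exactly to the pads and to its own spokes. The colours 1, …, ℓ may
-- repeat at distance 2, all others only at distance 3. Through a hub every vertex of X is within
-- distance 2 of every vertex of Y, so each of the colours 1, …, ℓ is used at most once in X and once
-- in Y, and every other colour at most once in X ∪ Y. Hence χ_S ≥ |X| + |Y| − ℓ, and colouring by
-- ranks attains this. Deleting a vertex other than a hub lowers the bound by one. Deleting h_j puts
-- its spokes at distance 3 from the base, so they may reuse base colours and χ_S drops by x_j.

module Submission where

open import Data.Bool using (Bool; true; false; not; _∨_)
open import Data.Bool.Properties using (T-≡; not-involutive)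
open import Data.Empty using (⊥; ⊥-elim)
open import Data.Fin using (Fin; zero; suc; toℕ; fromℕ<; punchIn; join; splitAt)
open import Data.Fin.Properties
  using (toℕ-fromℕ<; toℕ-injective; fromℕ<-injective; splitAt-join; punchIn-injective; injective⇒≤)
  renaming (_≟_ to _≟ᶠ_)
import Data.Fin.Properties as Finₚ
open import Data.List using (List; []; _∷_; _++_; replicate; length; lookup)
open import Data.List.Membership.Propositional using (_∈_)
open import Data.List.Relation.Unary.All using (All)
import Data.List.Relation.Unary.All as All
open import Data.List.Relation.Unary.Any using (here; there)
open import Data.Nat
open import Data.Nat.Properties
open import Algebra.Properties.CommutativeSemigroup +-commutativeSemigroup using (interchange)
open import Data.Nat.Solver using (module +-*-Solver)
open import Data.Product using (Σ; _,_; _×_; proj₁; proj₂)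
open import Data.Sum using (_⊎_; inj₁; inj₂)
open import Data.Sum.Properties using (inj₁-injective; inj₂-injective)
open import Function using (_∘_)
open import Function.Bundles using (_⇔_; mk⇔; Equivalence)
open import Relation.Binary.PropositionalEquality
open import Relation.Nullary using (Dec; yes; no)

open import Defs hiding (sym)

-- Counting over a finite vertex set

fromBool : Bool → ℕ
fromBool true  = 1
fromBool false = 0

fromBool≤1 : ∀ b → fromBool b ≤ 1
fromBool≤1 true  = ≤-refl
fromBool≤1 false = z≤n

count : ∀ {n} → (Fin n → Bool) → ℕ
count {zero}  f = 0
count {suc n} f = fromBool (f zero) + count (f ∘ suc)

rank : ∀ {n} → (Fin n → Bool) → Fin n → ℕ
rank f zero    = 0
rank f (suc v) = fromBool (f zero) + rank (f ∘ suc) v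

rank<count : ∀ {n} (f : Fin n → Bool) {v} → f v ≡ true → rank f v < count f
rank<count f {zero}  fv rewrite fv = s≤s z≤n
rank<count f {suc v} fv = +-monoʳ-< (fromBool (f zero)) (rank<count (f ∘ suc) fv)

rank-injective : ∀ {n} (f : Fin n → Bool) {v w} → f v ≡ true → f w ≡ true →
                 rank f v ≡ rank f w → v ≡ w
rank-injective f {zero}  {zero}  _  _  _ = refl
rank-injective f {zero}  {suc w} fv _  r rewrite fv with () ← r
rank-injective f {suc v} {zero}  _  fw r rewrite fw with () ← r
rank-injective f {suc v} {suc w} fv fw r =
  cong suc (rank-injective (f ∘ suc) fv fw (+-cancelˡ-≡ (fromBool (f zero)) _ _ r))

enumerate : ∀ {n} (f : Fin n → Bool) → Fin (count f) → Fin n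
enumerate {suc n} f t with f zero
enumerate {suc n} f zero    | true  = zero
enumerate {suc n} f (suc t) | true  = suc (enumerate (f ∘ suc) t)
enumerate {suc n} f t       | false = suc (enumerate (f ∘ suc) t)

enumerate-true : ∀ {n} (f : Fin n → Bool) t → f (enumerate f t) ≡ true
enumerate-true {suc n} f t with f zero in fz
enumerate-true {suc n} f zero    | true  = fz
enumerate-true {suc n} f (suc t) | true  = enumerate-true (f ∘ suc) t
enumerate-true {suc n} f t       | false = enumerate-true (f ∘ suc) t

enumerate-injective : ∀ {n} (f : Fin n → Bool) {t u} → enumerate f t ≡ enumerate f u → t ≡ u
enumerate-injective {suc n} f {t} {u} eq with f zero
enumerate-injective {suc n} f {zero}  {zero}  eq | true  = refl
enumerate-injective {suc n} f {suc t} {suc u} eq | true  =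
  cong suc (enumerate-injective (f ∘ suc) (Finₚ.suc-injective eq))
enumerate-injective {suc n} f {t}     {u}     eq | false =
  enumerate-injective (f ∘ suc) (Finₚ.suc-injective eq)

count≤-injectiveOn : ∀ {n m} (f : Fin n → Bool) (g : Fin n → Fin m) →
                     (∀ {v w} → f v ≡ true → f w ≡ true → g v ≡ g w → v ≡ w) → count f ≤ m
count≤-injectiveOn f g inj = injective⇒≤ {f = g ∘ enumerate f}
  λ {t} {u} eq → enumerate-injective f (inj (enumerate-true f t) (enumerate-true f u) eq)

count-positive : ∀ {n} (f : Fin n → Bool) v → f v ≡ true → 1 ≤ count f
count-positive f v fv = ≤-trans (s≤s z≤n) (rank<count f fv)

count-positive⇒∃ : ∀ {n} (f : Fin n → Bool) → 1 ≤ count f → Σ (Fin n) λ v → f v ≡ true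
count-positive⇒∃ f pos with count f | enumerate f | enumerate-true f
... | suc _ | e | e-true = e zero , e-true zero

count≡0⇒false : ∀ {n} (f : Fin n → Bool) v → count f ≡ 0 → f v ≡ false
count≡0⇒false f v c with f v in fv
... | false = refl
... | true  with () ← subst (rank f v <_) c (rank<count f fv)

count-punchIn : ∀ {n} (f : Fin (suc n) → Bool) u →
                count (f ∘ punchIn u) + fromBool (f u) ≡ count f
count-punchIn f zero = +-comm _ (fromBool (f zero))
count-punchIn {suc n} f (suc u) =
  trans (+-assoc (fromBool (f zero)) _ _) (cong (fromBool (f zero) +_) (count-punchIn (f ∘ suc) u))

count-+ : ∀ {n} (h f g : Fin n → Bool) → (∀ v → fromBool (h v) ≡ fromBool (f v) + fromBool (g v)) →
          count h ≡ count f + count g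
count-+ {zero}  h f g split = refl
count-+ {suc n} h f g split = begin
  fromBool (h zero) + count (h ∘ suc)
    ≡⟨ cong₂ _+_ (split zero) (count-+ (h ∘ suc) (f ∘ suc) (g ∘ suc) (split ∘ suc)) ⟩
  (fromBool (f zero) + fromBool (g zero)) + (count (f ∘ suc) + count (g ∘ suc))
    ≡⟨ interchange (fromBool (f zero)) (fromBool (g zero)) _ _ ⟩
  count f + count g ∎
  where open ≡-Reasoning

count-mono : ∀ {n} (f g : Fin n → Bool) → (∀ v → f v ≡ true → g v ≡ true) → count f ≤ count g
count-mono {zero}  f g f⇒g = z≤n
count-mono {suc n} f g f⇒g = +-mono-≤ (head (f zero) refl) (count-mono (f ∘ suc) (g ∘ suc) (f⇒g ∘ suc))
  where
  head : ∀ b → f zero ≡ b → fromBool b ≤ fromBool (g zero)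
  head true  fz rewrite f⇒g zero fz = ≤-refl
  head false _  = z≤n

count-punchIn-≤ : ∀ {n} (f : Fin (suc n) → Bool) u → count (f ∘ punchIn u) ≤ count f
count-punchIn-≤ f u = subst (count (f ∘ punchIn u) ≤_) (count-punchIn f u) (m≤m+n _ _)

count≤suc-count-punchIn : ∀ {n} (f : Fin (suc n) → Bool) u → count f ≤ suc (count (f ∘ punchIn u))
count≤suc-count-punchIn f u = subst (_≤ suc (count (f ∘ punchIn u))) (count-punchIn f u)
  (subst (count (f ∘ punchIn u) + fromBool (f u) ≤_) (+-comm (count (f ∘ punchIn u)) 1)
         (+-monoʳ-≤ (count (f ∘ punchIn u)) (fromBool≤1 (f u))))

count-punchIn-false : ∀ {n} (f : Fin (suc n) → Bool) u → f u ≡ false → count (f ∘ punchIn u) ≡ count f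
count-punchIn-false f u fu = begin
  count (f ∘ punchIn u)                         ≡⟨ +-identityʳ _ ⟨
  count (f ∘ punchIn u) + fromBool false        ≡⟨ cong (λ b → count (f ∘ punchIn u) + fromBool b) fu ⟨
  count (f ∘ punchIn u) + fromBool (f u)        ≡⟨ count-punchIn f u ⟩
  count f                                       ∎
  where open ≡-Reasoning

≡ᵇ-refl : ∀ j → (j ≡ᵇ j) ≡ true
≡ᵇ-refl j = Equivalence.to T-≡ (≡⇒≡ᵇ j j refl)

≡ᵇ-true⇒≡ : ∀ a b → (a ≡ᵇ b) ≡ true → a ≡ b
≡ᵇ-true⇒≡ a b eq = ≡ᵇ⇒≡ a b (Equivalence.from T-≡ eq)

≢⇒≡ᵇ-false : ∀ a b → a ≢ b → (a ≡ᵇ b) ≡ false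
≢⇒≡ᵇ-false a b a≢b with a ≡ᵇ b in eq
... | false = refl
... | true  = ⊥-elim (a≢b (≡ᵇ-true⇒≡ a b eq))

≡ᵇ-false⇒≢ : ∀ a b → (a ≡ᵇ b) ≡ false → a ≢ b
≡ᵇ-false⇒≢ a .a eq refl with () ← trans (sym eq) (≡ᵇ-refl a)

-- The packing distance of the colour with index t, i.e. of colour t + 1.

packing : ℕ → ℕ → ℕ
packing ℓ t = seq1ℓ2∞ ℓ (suc t)

packing-small : ∀ ℓ {t} → t < ℓ → packing ℓ t ≡ 1
packing-small ℓ {t} t<ℓ rewrite Equivalence.to T-≡ (≤⇒≤ᵇ t<ℓ) = refl

packing-large : ∀ ℓ {t} → ℓ ≤ t → packing ℓ t ≡ 2
packing-large ℓ {t} ℓ≤t with suc t ≤ᵇ ℓ in eq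
... | false = refl
... | true  = ⊥-elim (<⇒≱ (≤ᵇ⇒≤ (suc t) ℓ (Equivalence.from T-≡ eq)) ℓ≤t)

packing≤2 : ∀ ℓ t → packing ℓ t ≤ 2
packing≤2 ℓ t with suc t ≤ᵇ ℓ
... | true  = s≤s z≤n
... | false = ≤-refl

packing≥1 : ∀ ℓ t → 1 ≤ packing ℓ t
packing≥1 ℓ t with suc t ≤ᵇ ℓ
... | true  = ≤-refl
... | false = s≤s z≤n

data VertexType : Set where
  base  : VertexType
  hub   : ℕ → VertexType
  spoke : ℕ → VertexType
  pad   : VertexType

adjacentTypes : VertexType → VertexType → Bool
adjacentTypes base      base      = true
adjacentTypes base      (hub _)   = true
adjacentTypes base      (spoke _) = false
adjacentTypes base      pad       = false
adjacentTypes (hub _)   base      = true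
adjacentTypes (hub _)   (hub _)   = true
adjacentTypes (hub j)   (spoke k) = j ≡ᵇ k
adjacentTypes (hub _)   pad       = true
adjacentTypes (spoke _) base      = false
adjacentTypes (spoke k) (hub j)   = j ≡ᵇ k
adjacentTypes (spoke _) (spoke _) = true
adjacentTypes (spoke _) pad       = true
adjacentTypes pad       base      = false
adjacentTypes pad       (hub _)   = true
adjacentTypes pad       (spoke _) = true
adjacentTypes pad       pad       = true

adjacentTypes-sym : ∀ s t → adjacentTypes s t ≡ adjacentTypes t s
adjacentTypes-sym base      base      = refl
adjacentTypes-sym base      (hub _)   = refl
adjacentTypes-sym base      (spoke _) = refl
adjacentTypes-sym base      pad       = refl
adjacentTypes-sym (hub _)   base      = refl
adjacentTypes-sym (hub _)   (hub _)   = refl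
adjacentTypes-sym (hub _)   (spoke _) = refl
adjacentTypes-sym (hub _)   pad       = refl
adjacentTypes-sym (spoke _) base      = refl
adjacentTypes-sym (spoke _) (hub _)   = refl
adjacentTypes-sym (spoke _) (spoke _) = refl
adjacentTypes-sym (spoke _) pad       = refl
adjacentTypes-sym pad       base      = refl
adjacentTypes-sym pad       (hub _)   = refl
adjacentTypes-sym pad       (spoke _) = refl
adjacentTypes-sym pad       pad       = refl

isBase isHub isSpoke isPad : VertexType → Bool
isBase base = true
isBase _    = false
isHub (hub _) = true
isHub _       = false
isSpoke (spoke _) = true
isSpoke _         = false
isPad pad = true
isPad _   = false

isHubOf isSpokeOf : ℕ → VertexType → Bool
isHubOf j (hub k) = k ≡ᵇ j
isHubOf j _       = false
isSpokeOf j (spoke k) = k ≡ᵇ j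
isSpokeOf j _         = false

inY-except : ℕ → VertexType → Bool
inY-except j (spoke k) = not (k ≡ᵇ j)
inY-except j pad       = true
inY-except j _         = false

inX : VertexType → Bool
inX t = isBase t ∨ isHub t

inXY : ℕ → VertexType → Bool
inXY j t = inX t ∨ inY-except j t

isHubOf⇒≡hub : ∀ j t → isHubOf j t ≡ true → t ≡ hub j
isHubOf⇒≡hub j (hub k) eq = cong hub (≡ᵇ-true⇒≡ k j eq)

count≡0⇒no-hub : ∀ {m} (τ : Fin m → VertexType) j → count (isHubOf j ∘ τ) ≡ 0 → ∀ v → τ v ≢ hub j
count≡0⇒no-hub τ j none v τv≡hub with () ← trans (sym (count≡0⇒false (isHubOf j ∘ τ) v none))
                                                  (trans (cong (isHubOf j) τv≡hub) (≡ᵇ-refl j))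

count≡1⇒hub : ∀ {m} (τ : Fin m → VertexType) j → count (isHubOf j ∘ τ) ≡ 1 →
              Σ (Fin m) λ h → τ h ≡ hub j
count≡1⇒hub τ j one with count-positive⇒∃ (isHubOf j ∘ τ) (≤-reflexive (sym one))
... | h , th = h , isHubOf⇒≡hub j (τ h) th

_HasTypes_ : ∀ {N} → Graph N → (Fin N → VertexType) → Set
_HasTypes_ {N} H τ = ∀ x y → x ≢ y → adj H x y ≡ adjacentTypes (τ x) (τ y)

deleteVertex-hasTypes : ∀ {m} (G : Graph (suc m)) (τ : Fin (suc m) → VertexType) u →
                        G HasTypes τ → deleteVertex G u HasTypes (τ ∘ punchIn u)
deleteVertex-hasTypes G τ u typed x y x≢y =
  typed (punchIn u x) (punchIn u y) (x≢y ∘ punchIn-injective u x y)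

module TypedDistances {N} (H : Graph N) (τ : Fin N → VertexType) (typed : H HasTypes τ) where

  walk₁ : ∀ {x y} → x ≢ y → adjacentTypes (τ x) (τ y) ≡ true → Walk H x y 1
  walk₁ {x} {y} x≢y a = step (trans (typed x y x≢y) a) here

  walk₂ : ∀ {x w y} → x ≢ w → w ≢ y → adjacentTypes (τ x) (τ w) ≡ true →
          adjacentTypes (τ w) (τ y) ≡ true → Walk H x y 2
  walk₂ x≢w w≢y a₁ a₂ = step (trans (typed _ _ x≢w) a₁) (step (trans (typed _ _ w≢y) a₂) here)

  adj⇒adjacentTypes : ∀ {x y} → adj H x y ≡ true → adjacentTypes (τ x) (τ y) ≡ true
  adj⇒adjacentTypes {x} {y} e = trans (sym (typed x y x≢y)) e
    where
    x≢y : x ≢ y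
    x≢y refl with () ← trans (sym e) (irrefl H x)

  distGt₁ : ∀ {x y s t} → τ x ≡ s → τ y ≡ t → x ≢ y → adjacentTypes s t ≡ false → DistGt H x y 1
  distGt₁ refl refl x≢y na .0 here = ⊥-elim (x≢y refl)
  distGt₁ refl refl x≢y na .1 (step e here) with () ← trans (sym (adj⇒adjacentTypes e)) na
  distGt₁ refl refl x≢y na .(suc (suc _)) (step _ (step _ _)) = s≤s (s≤s z≤n)

  distGt₂ : ∀ {x y s t} → τ x ≡ s → τ y ≡ t → x ≢ y → adjacentTypes s t ≡ false →
            (∀ w → adjacentTypes s (τ w) ≡ true → adjacentTypes (τ w) t ≡ true → ⊥) →
            DistGt H x y 2
  distGt₂ refl refl x≢y na nc .0 here = ⊥-elim (x≢y refl)
  distGt₂ refl refl x≢y na nc .1 (step e here) with () ← trans (sym (adj⇒adjacentTypes e)) na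
  distGt₂ refl refl x≢y na nc .2 (step {w = w} e₁ (step e₂ here)) =
    ⊥-elim (nc w (adj⇒adjacentTypes e₁) (adj⇒adjacentTypes e₂))
  distGt₂ refl refl x≢y na nc .(suc (suc (suc _))) (step _ (step _ (step _ _))) = s≤s (s≤s (s≤s z≤n))

DistGt-mono : ∀ {N} {H : Graph N} {x y s s'} → s' ≤ s → DistGt H x y s → DistGt H x y s'
DistGt-mono s'≤s d l w = <-≤-trans (s≤s s'≤s) (d l w)

Walk-snoc : ∀ {N} {H : Graph N} {u v w l} → Walk H u v l → adj H v w ≡ true → Walk H u w (suc l)
Walk-snoc here         e = step e here
Walk-snoc (step e′ ws) e = step e′ (Walk-snoc ws e)

Walk-reverse : ∀ {N} {H : Graph N} {u v l} → Walk H u v l → Walk H v u l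
Walk-reverse           here                  = here
Walk-reverse {H = H} (step {u} {w} e ws) = Walk-snoc (Walk-reverse ws) (trans (Graph.sym H w u) e)

DistGt-sym : ∀ {N} {H : Graph N} {u v s} → DistGt H u v s → DistGt H v u s
DistGt-sym d l ws = d l (Walk-reverse ws)

X-clique : ∀ s t → inX s ≡ true → inX t ≡ true → adjacentTypes s t ≡ true
X-clique base    base    _ _ = refl
X-clique base    (hub _) _ _ = refl
X-clique (hub _) base    _ _ = refl
X-clique (hub _) (hub _) _ _ = refl

Y-clique : ∀ i s t → inY-except i s ≡ true → inY-except i t ≡ true → adjacentTypes s t ≡ true
Y-clique i (spoke _) (spoke _) _ _ = refl
Y-clique i (spoke _) pad       _ _ = refl
Y-clique i pad       (spoke _) _ _ = refl
Y-clique i pad       pad       _ _ = refl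

inY-except⇒¬inX : ∀ i t → inY-except i t ≡ true → inX t ≡ false
inY-except⇒¬inX i (spoke _) _ = refl
inY-except⇒¬inX i pad       _ = refl

isHub⇒inX : ∀ t → isHub t ≡ true → inX t ≡ true
isHub⇒inX (hub _) _ = refl

hub-pad-adjacent : ∀ t → isHub t ≡ true → adjacentTypes t pad ≡ true
hub-pad-adjacent (hub _) _ = refl

fromBool-inX : ∀ t → fromBool (inX t) ≡ fromBool (isBase t) + fromBool (isHub t)
fromBool-inX base      = refl
fromBool-inX (hub _)   = refl
fromBool-inX (spoke _) = refl
fromBool-inX pad       = refl

fromBool-inXY : ∀ i t → fromBool (inXY i t) ≡ fromBool (inX t) + fromBool (inY-except i t)
fromBool-inXY i base      = refl
fromBool-inXY i (hub _)   = refl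
fromBool-inXY i (spoke _) = refl
fromBool-inXY i pad       = refl

fromBool-inXY+spokes : ∀ i t → fromBool (inXY i t) + fromBool (isSpokeOf i t) ≡ 1
fromBool-inXY+spokes i base      = refl
fromBool-inXY+spokes i (hub _)   = refl
fromBool-inXY+spokes i pad       = refl
fromBool-inXY+spokes i (spoke k) with k ≡ᵇ i
... | true  = refl
... | false = refl

isPad⇒inY-except : ∀ i t → isPad t ≡ true → inY-except i t ≡ true
isPad⇒inY-except i pad _ = refl

count-isPad≤count-inY-except : ∀ {m} (τ : Fin m → VertexType) i →
                               count (isPad ∘ τ) ≤ count (inY-except i ∘ τ)
count-isPad≤count-inY-except τ i = count-mono (isPad ∘ τ) (inY-except i ∘ τ) (isPad⇒inY-except i ∘ τ)

isBase⇒≡base : ∀ t → isBase t ≡ true → t ≡ base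
isBase⇒≡base base _ = refl

-- The S-packing chromatic number of a typed graph

-- Hub i is missing from H (i = 0 if none is), so that its spokes may reuse colours of the base.

module TypedChiS (ℓ : ℕ) {N} (H : Graph N) (τ : Fin N → VertexType) (typed : H HasTypes τ) (i : ℕ)
  (no-hub-i : ∀ v → τ v ≢ hub i)
  (hub-of-spoke : ∀ v j → τ v ≡ spoke j → j ≢ i → Σ (Fin N) λ h → τ h ≡ hub j)
  (some-hub : Σ (Fin N) λ h → isHub (τ h) ≡ true)
  (ℓ≤#outer : ℓ ≤ count (inY-except i ∘ τ))
  (base-large : ℓ + count (isSpokeOf i ∘ τ) ≤ count (isBase ∘ τ)) where

  open TypedDistances H τ typed

  inBase inHubs inSpokes inOuter : Fin N → Bool
  inBase   = isBase ∘ τ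
  inHubs   = isHub ∘ τ
  inSpokes = isSpokeOf i ∘ τ
  inOuter  = inY-except i ∘ τ

  #base #hubs #spokes #outer : ℕ
  #base   = count inBase
  #hubs   = count inHubs
  #spokes = count inSpokes
  #outer  = count inOuter

  hubOffset χ : ℕ
  hubOffset = #base + (#outer ∸ ℓ)
  χ         = hubOffset + #hubs

  ℓ≤#base : ℓ ≤ #base
  ℓ≤#base = ≤-trans (m≤m+n ℓ #spokes) base-large

  -- The first ℓ outer vertices reuse the colours 1, …, ℓ of the base.

  outerColour : ℕ → ℕ
  outerColour t with t <? ℓ
  ... | yes _ = t
  ... | no  _ = #base + (t ∸ ℓ)

  outerColour-cases : ∀ t → (t < ℓ × outerColour t ≡ t) ⊎ (ℓ ≤ t × outerColour t ≡ #base + (t ∸ ℓ))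
  outerColour-cases t with t <? ℓ
  ... | yes t<ℓ = inj₁ (t<ℓ , refl)
  ... | no  t≮ℓ = inj₂ (≮⇒≥ t≮ℓ , refl)

  outerColour<hubOffset : ∀ {t} → t < #outer → outerColour t < hubOffset
  outerColour<hubOffset {t} t<#outer with outerColour-cases t
  ... | inj₁ (t<ℓ , eq) rewrite eq = <-≤-trans (<-≤-trans t<ℓ ℓ≤#base) (m≤m+n #base _)
  ... | inj₂ (ℓ≤t , eq) rewrite eq = +-monoʳ-< #base (∸-monoˡ-< t<#outer ℓ≤t)

  outerColour-injective : ∀ {t u} → outerColour t ≡ outerColour u → t ≡ u
  outerColour-injective {t} {u} eq with outerColour-cases t | outerColour-cases u
  ... | inj₁ (_ , et) | inj₁ (_ , eu) = trans (sym et) (trans eq eu)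
  ... | inj₂ (ℓ≤t , et) | inj₂ (ℓ≤u , eu) = begin
    t           ≡⟨ m∸n+n≡m ℓ≤t ⟨
    t ∸ ℓ + ℓ   ≡⟨ cong (_+ ℓ) (+-cancelˡ-≡ #base _ _ (trans (sym et) (trans eq eu))) ⟩
    u ∸ ℓ + ℓ   ≡⟨ m∸n+n≡m ℓ≤u ⟩
    u           ∎
    where open ≡-Reasoning
  ... | inj₁ (t<ℓ , et) | inj₂ (_ , eu) =
    ⊥-elim (<⇒≢ (<-≤-trans t<ℓ (≤-trans ℓ≤#base (m≤m+n #base _))) (trans (sym et) (trans eq eu)))
  ... | inj₂ (_ , et) | inj₁ (u<ℓ , eu) =
    ⊥-elim (<⇒≢ (<-≤-trans u<ℓ (≤-trans ℓ≤#base (m≤m+n #base _))) (sym (trans (sym et) (trans eq eu))))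

  outerColour≢spokeColour : ∀ t {r} → r < #spokes → outerColour t ≢ ℓ + r
  outerColour≢spokeColour t {r} r<#spokes eq with outerColour-cases t
  ... | inj₁ (t<ℓ , et) = <⇒≢ (<-≤-trans (subst (_< ℓ) (sym et) t<ℓ) (m≤m+n ℓ r)) eq
  ... | inj₂ (_ , et) = <⇒≢ (<-≤-trans (+-monoʳ-< ℓ r<#spokes)
                                       (≤-trans base-large (subst (#base ≤_) (sym et) (m≤m+n #base _))))
                            (sym eq)

  spokeColour : Bool → Fin N → ℕ
  spokeColour true  v = ℓ + rank inSpokes v
  spokeColour false v = outerColour (rank inOuter v)

  colourByType : VertexType → Fin N → ℕ
  colourByType base      v = rank inBase v
  colourByType (hub _)   v = hubOffset + rank inHubs v
  colourByType (spoke j) v = spokeColour (j ≡ᵇ i) v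
  colourByType pad       v = outerColour (rank inOuter v)

  colour : Fin N → ℕ
  colour v = colourByType (τ v) v

  data ColourClass (v : Fin N) : Set where
    baseᶜ  : τ v ≡ base → inBase v ≡ true → colour v ≡ rank inBase v → ColourClass v
    hubᶜ   : inHubs v ≡ true → colour v ≡ hubOffset + rank inHubs v → ColourClass v
    spokeᶜ : τ v ≡ spoke i → inSpokes v ≡ true → colour v ≡ ℓ + rank inSpokes v → ColourClass v
    outerᶜ : inOuter v ≡ true → colour v ≡ outerColour (rank inOuter v) → ColourClass v

  colourClass : ∀ v → ColourClass v
  colourClass v with τ v in tv
  ... | base    = baseᶜ tv (cong isBase tv) (cong (λ t → colourByType t v) tv)
  ... | hub _   = hubᶜ (cong isHub tv) (cong (λ t → colourByType t v) tv)
  ... | pad     = outerᶜ (cong (inY-except i) tv) (cong (λ t → colourByType t v) tv)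
  ... | spoke j with j ≡ᵇ i in j≡ᵇi
  ...   | true  = spokeᶜ (trans tv (cong spoke (≡ᵇ-true⇒≡ j i j≡ᵇi)))
                         (trans (cong (isSpokeOf i) tv) j≡ᵇi)
                         (trans (cong (λ t → colourByType t v) tv) (cong (λ b → spokeColour b v) j≡ᵇi))
  ...   | false = outerᶜ (trans (cong (inY-except i) tv) (cong not j≡ᵇi))
                         (trans (cong (λ t → colourByType t v) tv) (cong (λ b → spokeColour b v) j≡ᵇi))

  colour<χ : ∀ v → colour v < χ
  colour<χ v with colourClass v
  ... | baseᶜ _ b c rewrite c = <-≤-trans (rank<count inBase b) (≤-trans (m≤m+n #base _) (m≤m+n hubOffset #hubs))
  ... | hubᶜ h c rewrite c = +-monoʳ-< hubOffset (rank<count inHubs h)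
  ... | spokeᶜ _ s c rewrite c = <-≤-trans (+-monoʳ-< ℓ (rank<count inSpokes s))
                                   (≤-trans base-large (≤-trans (m≤m+n #base _) (m≤m+n hubOffset #hubs)))
  ... | outerᶜ o c rewrite c = <-≤-trans (outerColour<hubOffset (rank<count inOuter o)) (m≤m+n hubOffset #hubs)

  base-spoke-common : ∀ t → adjacentTypes base t ≡ true → adjacentTypes t (spoke i) ≡ true → t ≡ hub i
  base-spoke-common (hub j) _ j≡ᵇi = cong hub (≡ᵇ-true⇒≡ j i j≡ᵇi)

  base-spoke-distGt₂ : ∀ {v w} → τ v ≡ base → τ w ≡ spoke i → v ≢ w → DistGt H v w 2
  base-spoke-distGt₂ tv tw v≢w = distGt₂ tv tw v≢w refl
    λ x a₁ a₂ → no-hub-i x (base-spoke-common (τ x) a₁ a₂)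

  base-outer-nonadjacent : ∀ t → inY-except i t ≡ true → adjacentTypes base t ≡ false
  base-outer-nonadjacent (spoke _) _ = refl
  base-outer-nonadjacent pad       _ = refl

  base-outer-distGt₁ : ∀ {v w} → τ v ≡ base → inOuter w ≡ true → v ≢ w → DistGt H v w 1
  base-outer-distGt₁ {w = w} tv ow v≢w = distGt₁ tv refl v≢w (base-outer-nonadjacent (τ w) ow)

  below-hubs : ∀ {a} r → a < hubOffset → a ≢ hubOffset + r
  below-hubs r a<h = <⇒≢ (<-≤-trans a<h (m≤m+n hubOffset r))

  rankBase<hubOffset : ∀ {v} → inBase v ≡ true → rank inBase v < hubOffset
  rankBase<hubOffset b = <-≤-trans (rank<count inBase b) (m≤m+n #base _)

  spokeColour<#base : ∀ {v} → inSpokes v ≡ true → ℓ + rank inSpokes v < #base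
  spokeColour<#base s = <-≤-trans (+-monoʳ-< ℓ (rank<count inSpokes s)) base-large

  base-outer-clash : ∀ {v w} → τ v ≡ base → inBase v ≡ true → inOuter w ≡ true → v ≢ w →
                     rank inBase v ≡ outerColour (rank inOuter w) → DistGt H v w (packing ℓ (rank inBase v))
  base-outer-clash {v} {w} tv b o v≢w eq with outerColour-cases (rank inOuter w)
  ... | inj₁ (t<ℓ , et) rewrite packing-small ℓ (subst (_< ℓ) (sym (trans eq et)) t<ℓ) =
    base-outer-distGt₁ tv o v≢w
  ... | inj₂ (_ , et) =
    ⊥-elim (<⇒≢ (<-≤-trans (rank<count inBase b) (m≤m+n #base _)) (trans eq et))

  colour-packing : ∀ {v w} → v ≢ w → colour v ≡ colour w → DistGt H v w (packing ℓ (colour v))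
  colour-packing {v} {w} v≢w same with colourClass v | colourClass w
  ... | baseᶜ _ bv cv | baseᶜ _ bw cw =
    ⊥-elim (v≢w (rank-injective inBase bv bw (subst₂ _≡_ cv cw same)))
  ... | hubᶜ hv cv | hubᶜ hw cw =
    ⊥-elim (v≢w (rank-injective inHubs hv hw (+-cancelˡ-≡ hubOffset _ _ (subst₂ _≡_ cv cw same))))
  ... | spokeᶜ _ sv cv | spokeᶜ _ sw cw =
    ⊥-elim (v≢w (rank-injective inSpokes sv sw (+-cancelˡ-≡ ℓ _ _ (subst₂ _≡_ cv cw same))))
  ... | outerᶜ ov cv | outerᶜ ow cw =
    ⊥-elim (v≢w (rank-injective inOuter ov ow (outerColour-injective (subst₂ _≡_ cv cw same))))
  ... | baseᶜ tv _ _ | spokeᶜ tw _ _ = DistGt-mono (packing≤2 ℓ _) (base-spoke-distGt₂ tv tw v≢w)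
  ... | spokeᶜ tv _ _ | baseᶜ tw _ _ =
    DistGt-mono (packing≤2 ℓ _) (DistGt-sym (base-spoke-distGt₂ tw tv (v≢w ∘ sym)))
  ... | baseᶜ tv bv cv | outerᶜ ow cw = subst (DistGt H v w ∘ packing ℓ) (sym cv)
    (base-outer-clash tv bv ow v≢w (subst₂ _≡_ cv cw same))
  ... | outerᶜ ov cv | baseᶜ tw bw cw = subst (DistGt H v w ∘ packing ℓ) (trans (sym cw) (sym same))
    (DistGt-sym (base-outer-clash tw bw ov (v≢w ∘ sym) (subst₂ _≡_ cw cv (sym same))))
  ... | hubᶜ _ cv | baseᶜ _ bw cw = ⊥-elim (below-hubs _ (rankBase<hubOffset bw) (subst₂ _≡_ cw cv (sym same)))
  ... | baseᶜ _ bv cv | hubᶜ _ cw = ⊥-elim (below-hubs _ (rankBase<hubOffset bv) (subst₂ _≡_ cv cw same))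
  ... | hubᶜ _ cv | spokeᶜ _ sw cw =
    ⊥-elim (below-hubs _ (<-≤-trans (spokeColour<#base sw) (m≤m+n #base _)) (subst₂ _≡_ cw cv (sym same)))
  ... | spokeᶜ _ sv cv | hubᶜ _ cw =
    ⊥-elim (below-hubs _ (<-≤-trans (spokeColour<#base sv) (m≤m+n #base _)) (subst₂ _≡_ cv cw same))
  ... | hubᶜ _ cv | outerᶜ ow cw =
    ⊥-elim (below-hubs _ (outerColour<hubOffset (rank<count inOuter ow)) (subst₂ _≡_ cw cv (sym same)))
  ... | outerᶜ ov cv | hubᶜ _ cw =
    ⊥-elim (below-hubs _ (outerColour<hubOffset (rank<count inOuter ov)) (subst₂ _≡_ cv cw same))
  ... | spokeᶜ _ sv cv | outerᶜ _ cw =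
    ⊥-elim (outerColour≢spokeColour _ (rank<count inSpokes sv) (subst₂ _≡_ cw cv (sym same)))
  ... | outerᶜ _ cv | spokeᶜ _ sw cw =
    ⊥-elim (outerColour≢spokeColour _ (rank<count inSpokes sw) (subst₂ _≡_ cv cw same))

  packingColouring : Fin N → Fin χ
  packingColouring v = fromℕ< (colour<χ v)

  packingColouring-valid : IsSPackingColoring (seq1ℓ2∞ ℓ) H χ packingColouring
  packingColouring-valid v w v≢w same rewrite toℕ-fromℕ< (colour<χ v) =
    colour-packing v≢w (subst₂ _≡_ (toℕ-fromℕ< (colour<χ v)) (toℕ-fromℕ< (colour<χ w)) (cong toℕ same))

  Near : Fin N → Fin N → Set
  Near v w = Walk H v w 1 ⊎ Walk H v w 2

  Near⇒¬DistGt₂ : ∀ {v w} → Near v w → DistGt H v w 2 → ⊥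
  Near⇒¬DistGt₂ (inj₁ walk) far = <⇒≱ (far 1 walk) (s≤s z≤n)
  Near⇒¬DistGt₂ (inj₂ walk) far = <-irrefl refl (far 2 walk)

  X-outer-distinct : ∀ {v w} → inX (τ v) ≡ true → inOuter w ≡ true → v ≢ w
  X-outer-distinct {v} a o refl with () ← trans (sym a) (inY-except⇒¬inX i (τ v) o)

  outer-hub-neighbour : ∀ w → inOuter w ≡ true →
                        Σ (Fin N) λ h → isHub (τ h) ≡ true × adjacentTypes (τ h) (τ w) ≡ true
  outer-hub-neighbour w o with τ w in tw
  ... | pad = let h , hh = some-hub in h , hh , hub-pad-adjacent (τ h) hh
  ... | spoke j with hub-of-spoke w j tw (≡ᵇ-false⇒≢ j i (trans (sym (not-involutive _)) (cong not o)))
  ...   | h , th = h , cong isHub th , trans (cong (λ t → adjacentTypes t (spoke j)) th) (≡ᵇ-refl j)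

  -- Each outer vertex has a hub neighbour, and the hubs are adjacent to all of X.

  X-outer-near : ∀ {v w} → inX (τ v) ≡ true → inOuter w ≡ true → Near v w
  X-outer-near {v} {w} a o with outer-hub-neighbour w o
  ... | h , hh , hw with v ≟ᶠ h
  ...   | yes refl = inj₁ (walk₁ (X-outer-distinct a o) hw)
  ...   | no  v≢h  = inj₂ (walk₂ v≢h (X-outer-distinct ah o) (X-clique (τ v) (τ h) a ah) hw)
    where ah = isHub⇒inX (τ h) hh

  module LowerBound {k} (c : Fin N → Fin k) (valid : IsSPackingColoring (seq1ℓ2∞ ℓ) H k c) where

    adjacent⇒colour≢ : ∀ {v w} → v ≢ w → adjacentTypes (τ v) (τ w) ≡ true → c v ≢ c w
    adjacent⇒colour≢ v≢w a same = <⇒≱ (valid _ _ v≢w same 1 (walk₁ v≢w a)) (packing≥1 ℓ _)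

    near⇒small : ∀ {v w} → v ≢ w → Near v w → c v ≡ c w → toℕ (c v) < ℓ
    near⇒small {v} {w} v≢w near same with toℕ (c v) <? ℓ
    ... | yes small = small
    ... | no  large = ⊥-elim (Near⇒¬DistGt₂ near
                        (subst (DistGt H v w) (packing-large ℓ (≮⇒≥ large)) (valid v w v≢w same)))

    -- Outer vertices with one of the colours 1, …, ℓ are sent to a separate copy of these colours.

    liftBy : Bool → (w : Fin N) → Dec (toℕ (c w) < ℓ) → Fin k ⊎ Fin ℓ
    liftBy false w (yes small) = inj₂ (fromℕ< small)
    liftBy _     w _           = inj₁ (c w)

    lift : Fin N → Fin k ⊎ Fin ℓ
    lift w = liftBy (inX (τ w)) w (toℕ (c w) <? ℓ)

    lift-X : ∀ {w} → inX (τ w) ≡ true → lift w ≡ inj₁ (c w)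
    lift-X {w} a = cong (λ b → liftBy b w (toℕ (c w) <? ℓ)) a

    data OuterLift (w : Fin N) : Set where
      small : (s : toℕ (c w) < ℓ) → lift w ≡ inj₂ (fromℕ< s) → OuterLift w
      large : ℓ ≤ toℕ (c w) → lift w ≡ inj₁ (c w) → OuterLift w

    outerLift : ∀ {w} → inOuter w ≡ true → OuterLift w
    outerLift {w} o with toℕ (c w) <? ℓ in d
    ... | yes s = small s (trans lift≡ (cong (liftBy false w) d))
      where lift≡ = cong (λ b → liftBy b w (toℕ (c w) <? ℓ)) (inY-except⇒¬inX i (τ w) o)
    ... | no  l = large (≮⇒≥ l) (trans lift≡ (cong (liftBy false w) d))
      where lift≡ = cong (λ b → liftBy b w (toℕ (c w) <? ℓ)) (inY-except⇒¬inX i (τ w) o)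

    X-outer-lift≢ : ∀ {v w} → inX (τ v) ≡ true → inOuter w ≡ true → lift v ≢ lift w
    X-outer-lift≢ {v} {w} a o eq with outerLift o
    ... | small _ lw with () ← trans (sym (lift-X a)) (trans eq lw)
    ... | large ℓ≤c lw = <⇒≱ (near⇒small (X-outer-distinct a o) (X-outer-near a o) same)
                             (subst (λ x → ℓ ≤ toℕ x) (sym same) ℓ≤c)
      where same = inj₁-injective (trans (sym (lift-X a)) (trans eq lw))

    outer-lift≢ : ∀ {v w} → v ≢ w → inOuter v ≡ true → inOuter w ≡ true → lift v ≢ lift w
    outer-lift≢ {v} {w} v≢w ov ow eq with outerLift ov | outerLift ow
    ... | small s lv | small t lw = adjacent⇒colour≢ v≢w (Y-clique i (τ v) (τ w) ov ow)
      (toℕ-injective (fromℕ<-injective _ _ s t (inj₂-injective (trans (sym lv) (trans eq lw)))))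
    ... | large _ lv | large _ lw = adjacent⇒colour≢ v≢w (Y-clique i (τ v) (τ w) ov ow)
      (inj₁-injective (trans (sym lv) (trans eq lw)))
    ... | small _ lv | large _ lw with () ← trans (sym lv) (trans eq lw)
    ... | large _ lv | small _ lw with () ← trans (sym lv) (trans eq lw)

    X-or-outer : ∀ {v} → inXY i (τ v) ≡ true → inX (τ v) ≡ true ⊎ inOuter v ≡ true
    X-or-outer {v} ab with inX (τ v)
    ... | true  = inj₁ refl
    ... | false = inj₂ ab

    lift-injectiveOn : ∀ {v w} → inXY i (τ v) ≡ true → inXY i (τ w) ≡ true → lift v ≡ lift w → v ≡ w
    lift-injectiveOn {v} {w} abv abw eq with v ≟ᶠ w
    ... | yes v≡w = v≡w
    ... | no  v≢w with X-or-outer abv | X-or-outer abw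
    ...   | inj₁ av | inj₁ aw = ⊥-elim (adjacent⇒colour≢ v≢w (X-clique (τ v) (τ w) av aw)
                                  (inj₁-injective (trans (sym (lift-X av)) (trans eq (lift-X aw)))))
    ...   | inj₁ av | inj₂ ow = ⊥-elim (X-outer-lift≢ av ow eq)
    ...   | inj₂ ov | inj₁ aw = ⊥-elim (X-outer-lift≢ aw ov (sym eq))
    ...   | inj₂ ov | inj₂ ow = ⊥-elim (outer-lift≢ v≢w ov ow eq)

    #XY≤k+ℓ : count (inXY i ∘ τ) ≤ k + ℓ
    #XY≤k+ℓ = count≤-injectiveOn (inXY i ∘ τ) (join k ℓ ∘ lift) λ abv abw eq →
      lift-injectiveOn abv abw (subst₂ _≡_ (splitAt-join k ℓ _) (splitAt-join k ℓ _) (cong (splitAt k) eq))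

  χ+ℓ≡#XY : χ + ℓ ≡ count (inXY i ∘ τ)
  χ+ℓ≡#XY = begin
    #base + (#outer ∸ ℓ) + #hubs + ℓ  ≡⟨ solve 4 (λ b o h l → b :+ o :+ h :+ l := b :+ h :+ (o :+ l)) refl
                                                  #base (#outer ∸ ℓ) #hubs ℓ ⟩
    #base + #hubs + (#outer ∸ ℓ + ℓ)  ≡⟨ cong (#base + #hubs +_) (m∸n+n≡m ℓ≤#outer) ⟩
    #base + #hubs + #outer            ≡⟨ cong (_+ #outer) (count-+ _ _ _ (fromBool-inX ∘ τ)) ⟨
    count (inX ∘ τ) + #outer          ≡⟨ count-+ _ _ _ (fromBool-inXY i ∘ τ) ⟨
    count (inXY i ∘ τ) ∎
    where open ≡-Reasoning
          open +-*-Solver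

  χS : IsChiS (seq1ℓ2∞ ℓ) H χ
  χS = (packingColouring , packingColouring-valid) ,
       λ k (c , valid) → +-cancelʳ-≤ ℓ χ k
                           (subst (_≤ k + ℓ) (sym χ+ℓ≡#XY) (LowerBound.#XY≤k+ℓ c valid))

-- The construction

countList : (VertexType → Bool) → List VertexType → ℕ
countList f []       = 0
countList f (t ∷ ts) = fromBool (f t) + countList f ts

count-lookup : ∀ f ts → count (f ∘ lookup ts) ≡ countList f ts
count-lookup f []       = refl
count-lookup f (t ∷ ts) = cong (fromBool (f t) +_) (count-lookup f ts)

countList-++ : ∀ f ts us → countList f (ts ++ us) ≡ countList f ts + countList f us
countList-++ f []       us = refl
countList-++ f (t ∷ ts) us = trans (cong (fromBool (f t) +_) (countList-++ f ts us)) (sym (+-assoc (fromBool (f t)) _ _))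

countList-replicate-false : ∀ f t n → f t ≡ false → countList f (replicate n t) ≡ 0
countList-replicate-false f t zero    ft = refl
countList-replicate-false f t (suc n) ft rewrite ft = countList-replicate-false f t n ft

countList-replicate-true : ∀ f t n → f t ≡ true → countList f (replicate n t) ≡ n
countList-replicate-true f t zero    ft = refl
countList-replicate-true f t (suc n) ft rewrite ft = cong suc (countList-replicate-true f t n ft)

countList-mono : ∀ f g ts → (∀ t → f t ≡ true → g t ≡ true) → countList f ts ≤ countList g ts
countList-mono f g []       f⇒g = z≤n
countList-mono f g (t ∷ ts) f⇒g = +-mono-≤ (head (f t) refl) (countList-mono f g ts f⇒g)
  where
  head : ∀ b → f t ≡ b → fromBool b ≤ fromBool (g t)
  head true  ft rewrite f⇒g t ft = ≤-refl
  head false _  = z≤n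

typeAdjacency : ∀ {n} {x y : Fin n} → Dec (x ≡ y) → VertexType → VertexType → Bool
typeAdjacency (yes _) _ _ = false
typeAdjacency (no  _) s t = adjacentTypes s t

typedGraph : (ts : List VertexType) → Graph (length ts)
typedGraph ts = record
  { adj    = λ x y → typeAdjacency (x ≟ᶠ y) (lookup ts x) (lookup ts y)
  ; sym    = λ x y → symmetric x y (x ≟ᶠ y) (y ≟ᶠ x)
  ; irrefl = λ x → irreflexive x (x ≟ᶠ x)
  }
  where
  symmetric : ∀ x y (x≟y : Dec (x ≡ y)) (y≟x : Dec (y ≡ x)) →
              typeAdjacency x≟y (lookup ts x) (lookup ts y) ≡ typeAdjacency y≟x (lookup ts y) (lookup ts x)
  symmetric x y (yes _)   (yes _)   = refl
  symmetric x y (no  _)   (no  _)   = adjacentTypes-sym (lookup ts x) (lookup ts y)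
  symmetric x y (yes x≡y) (no  y≢x) = ⊥-elim (y≢x (sym x≡y))
  symmetric x y (no  x≢y) (yes y≡x) = ⊥-elim (x≢y (sym y≡x))
  irreflexive : ∀ x (x≟x : Dec (x ≡ x)) → typeAdjacency x≟x (lookup ts x) (lookup ts x) ≡ false
  irreflexive x (yes _)   = refl
  irreflexive x (no  x≢x) = ⊥-elim (x≢x refl)

typedGraph-hasTypes : ∀ ts → typedGraph ts HasTypes lookup ts
typedGraph-hasTypes ts x y x≢y with x ≟ᶠ y
... | yes x≡y = ⊥-elim (x≢y x≡y)
... | no  _   = refl

hubsAndSpokes : List ℕ → ℕ → List VertexType
hubsAndSpokes []      j = []
hubsAndSpokes (x ∷ L) j = hub j ∷ (replicate (pred x) (spoke j) ++ hubsAndSpokes L (suc j))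

countList-hubsAndSpokes-∷ : ∀ f x L j → countList f (hubsAndSpokes (x ∷ L) j) ≡
  fromBool (f (hub j)) + (countList f (replicate (pred x) (spoke j)) + countList f (hubsAndSpokes L (suc j)))
countList-hubsAndSpokes-∷ f x L j =
  cong (fromBool (f (hub j)) +_) (countList-++ f (replicate (pred x) (spoke j)) (hubsAndSpokes L (suc j)))

HubSpokeCounts : ℕ → List VertexType → ℕ → ℕ → Set
HubSpokeCounts j ts h s = countList (isHubOf j) ts ≡ h × countList (isSpokeOf j) ts ≡ s

hubsAndSpokes-skip : ∀ x L {j₀ j h s} → j₀ ≢ j → HubSpokeCounts j (hubsAndSpokes L (suc j₀)) h s →
                     HubSpokeCounts j (hubsAndSpokes (x ∷ L) j₀) h s
hubsAndSpokes-skip x L {j₀} {j} j₀≢j (hc , sc) =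
  trans (countList-hubsAndSpokes-∷ (isHubOf j) x L j₀)
        (cong₂ _+_ (cong fromBool j₀≢ᵇj) (cong₂ _+_ (countList-replicate-false (isHubOf j) (spoke j₀) (pred x) refl) hc)) ,
  trans (countList-hubsAndSpokes-∷ (isSpokeOf j) x L j₀)
        (cong₂ _+_ refl (cong₂ _+_ (countList-replicate-false (isSpokeOf j) (spoke j₀) (pred x) j₀≢ᵇj) sc))
  where j₀≢ᵇj = ≢⇒≡ᵇ-false j₀ j j₀≢j

hubsAndSpokes-here : ∀ x L {j} → HubSpokeCounts j (hubsAndSpokes L (suc j)) 0 0 →
                     HubSpokeCounts j (hubsAndSpokes (x ∷ L) j) 1 (pred x)
hubsAndSpokes-here x L {j} (hc , sc) =
  trans (countList-hubsAndSpokes-∷ (isHubOf j) x L j)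
        (cong₂ _+_ (cong fromBool (≡ᵇ-refl j))
                   (cong₂ _+_ (countList-replicate-false (isHubOf j) (spoke j) (pred x) refl) hc)) ,
  trans (countList-hubsAndSpokes-∷ (isSpokeOf j) x L j)
        (trans (cong₂ _+_ (countList-replicate-true (isSpokeOf j) (spoke j) (pred x) (≡ᵇ-refl j)) sc) (+-identityʳ (pred x)))

hubsAndSpokes-below : ∀ L {j₀ j} → j < j₀ → HubSpokeCounts j (hubsAndSpokes L j₀) 0 0
hubsAndSpokes-below []      j<j₀ = refl , refl
hubsAndSpokes-below (x ∷ L) j<j₀ =
  hubsAndSpokes-skip x L (>⇒≢ j<j₀) (hubsAndSpokes-below L (m≤n⇒m≤1+n j<j₀))

hubsAndSpokes-index : ∀ L j₀ j → HubSpokeCounts j (hubsAndSpokes L j₀) 0 0 ⊎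
                      Σ ℕ λ x → x ∈ L × HubSpokeCounts j (hubsAndSpokes L j₀) 1 (pred x)
hubsAndSpokes-index []      j₀ j = inj₁ (refl , refl)
hubsAndSpokes-index (x ∷ L) j₀ j with j₀ ≟ j | hubsAndSpokes-index L (suc j₀) j
... | yes refl | _ = inj₂ (x , here refl , hubsAndSpokes-here x L (hubsAndSpokes-below L ≤-refl))
... | no  j₀≢j | inj₁ none          = inj₁ (hubsAndSpokes-skip x L j₀≢j none)
... | no  j₀≢j | inj₂ (y , y∈ , one) = inj₂ (y , there y∈ , hubsAndSpokes-skip x L j₀≢j one)

hubsAndSpokes-∈ : ∀ L j₀ {x} → x ∈ L → Σ ℕ λ j → j₀ ≤ j × HubSpokeCounts j (hubsAndSpokes L j₀) 1 (pred x)
hubsAndSpokes-∈ (y ∷ L) j₀ (here refl) = j₀ , ≤-refl , hubsAndSpokes-here y L (hubsAndSpokes-below L ≤-refl)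
hubsAndSpokes-∈ (y ∷ L) j₀ (there x∈) with hubsAndSpokes-∈ L (suc j₀) x∈
... | j , j₀<j , one = j , <⇒≤ j₀<j , hubsAndSpokes-skip y L (<⇒≢ j₀<j) one

hubsAndSpokes-#hubs : ∀ L j → countList isHub (hubsAndSpokes L j) ≡ length L
hubsAndSpokes-#hubs []      j = refl
hubsAndSpokes-#hubs (x ∷ L) j = trans (countList-hubsAndSpokes-∷ isHub x L j)
  (cong suc (cong₂ _+_ (countList-replicate-false isHub (spoke j) (pred x) refl) (hubsAndSpokes-#hubs L (suc j))))

hubsAndSpokes-other : ∀ f L j → (∀ k → f (hub k) ≡ false) → (∀ k → f (spoke k) ≡ false) →
                      countList f (hubsAndSpokes L j) ≡ 0
hubsAndSpokes-other f []      j fh fs = refl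
hubsAndSpokes-other f (x ∷ L) j fh fs = trans (countList-hubsAndSpokes-∷ f x L j)
  (cong₂ _+_ (cong fromBool (fh j))
             (cong₂ _+_ (countList-replicate-false f (spoke j) (pred x) (fs j)) (hubsAndSpokes-other f L (suc j) fh fs)))

IsChiS-unique : ∀ {N} {s} {H : Graph N} {k k′} → IsChiS s H k → IsChiS s H k′ → k ≡ k′
IsChiS-unique (c , least) (c′ , least′) = ≤-antisym (least _ c′) (least′ _ c)

module Construction (ℓ a : ℕ) (as : List ℕ) (a∷as>1 : All (1 <_) (a ∷ as)) where

  -- a occurs twice, so that a hub remains after deleting any vertex.

  L : List ℕ
  L = a ∷ a ∷ as

  #spokesTotal : ℕ
  #spokesTotal = countList isSpoke (hubsAndSpokes L 1)

  baseSize : ℕ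
  baseSize = suc (ℓ + #spokesTotal)

  types : List VertexType
  types = replicate baseSize base ++ replicate (suc ℓ) pad ++ hubsAndSpokes L 1

  G : Graph (length types)
  G = typedGraph types

  τ : Fin (length types) → VertexType
  τ = lookup types

  #_ : (VertexType → Bool) → ℕ
  # f = count (f ∘ τ)

  #-types : ∀ f → # f ≡ countList f (replicate baseSize base) +
                        (countList f (replicate (suc ℓ) pad) + countList f (hubsAndSpokes L 1))
  #-types f = trans (count-lookup f types)
    (trans (countList-++ f (replicate baseSize base) (replicate (suc ℓ) pad ++ hubsAndSpokes L 1))
           (cong (countList f (replicate baseSize base) +_) (countList-++ f (replicate (suc ℓ) pad) (hubsAndSpokes L 1))))

  #-hubsAndSpokes : ∀ f → f base ≡ false → f pad ≡ false → # f ≡ countList f (hubsAndSpokes L 1)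
  #-hubsAndSpokes f fb fp = trans (#-types f)
    (cong₂ _+_ (countList-replicate-false f base baseSize fb)
               (cong (_+ countList f (hubsAndSpokes L 1)) (countList-replicate-false f pad (suc ℓ) fp)))

  #isBase≡ : # isBase ≡ baseSize
  #isBase≡ = trans (#-types isBase) (trans (cong₂ _+_ (countList-replicate-true isBase base baseSize refl)
    (cong₂ _+_ (countList-replicate-false isBase pad (suc ℓ) refl)
               (hubsAndSpokes-other isBase L 1 (λ _ → refl) (λ _ → refl))))
    (+-identityʳ baseSize))

  #isPad≡ : # isPad ≡ suc ℓ
  #isPad≡ = trans (#-types isPad) (trans
    (cong₂ _+_ (countList-replicate-false isPad base baseSize refl)
               (cong₂ _+_ (countList-replicate-true isPad pad (suc ℓ) refl)
                          (hubsAndSpokes-other isPad L 1 (λ _ → refl) (λ _ → refl))))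
    (+-identityʳ (suc ℓ)))

  #isHub≡ : # isHub ≡ 2 + length as
  #isHub≡ = trans (#-hubsAndSpokes isHub refl refl) (hubsAndSpokes-#hubs L 1)

  #spokesOf≤ : ∀ j → # (isSpokeOf j) ≤ #spokesTotal
  #spokesOf≤ j = subst (_≤ #spokesTotal) (sym (#-hubsAndSpokes (isSpokeOf j) refl refl))
    (countList-mono (isSpokeOf j) isSpoke (hubsAndSpokes L 1) spokeOf⇒spoke)
    where
    spokeOf⇒spoke : ∀ t → isSpokeOf j t ≡ true → isSpoke t ≡ true
    spokeOf⇒spoke (spoke _) _ = refl

  counts : ∀ {j h s} → HubSpokeCounts j (hubsAndSpokes L 1) h s → # (isHubOf j) ≡ h × # (isSpokeOf j) ≡ s
  counts (hc , sc) = trans (#-hubsAndSpokes (isHubOf _) refl refl) hc ,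
                     trans (#-hubsAndSpokes (isSpokeOf _) refl refl) sc

  #hubsOf0 : # (isHubOf 0) ≡ 0
  #hubsOf0 = proj₁ (counts (hubsAndSpokes-below L (s≤s z≤n)))

  #spokesOf0 : # (isSpokeOf 0) ≡ 0
  #spokesOf0 = proj₂ (counts (hubsAndSpokes-below L (s≤s z≤n)))

  one-hub : ∀ j → 1 ≤ # (isHubOf j) ⊎ 1 ≤ # (isSpokeOf j) →
            # (isHubOf j) ≡ 1 × Σ ℕ λ x → x ∈ L × # (isSpokeOf j) ≡ pred x
  one-hub j present with hubsAndSpokes-index L 1 j
  ... | inj₂ (x , x∈L , one) = proj₁ (counts one) , x , x∈L , proj₂ (counts one)
  ... | inj₁ none with present
  ...   | inj₁ 1≤h = ⊥-elim (<⇒≱ 1≤h (≤-reflexive (proj₁ (counts none))))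
  ...   | inj₂ 1≤s = ⊥-elim (<⇒≱ 1≤s (≤-reflexive (proj₂ (counts none))))

  spoke⇒one-hub : ∀ {v j} → τ v ≡ spoke j → # (isHubOf j) ≡ 1
  spoke⇒one-hub {v} {j} τv =
    proj₁ (one-hub j (inj₂ (count-positive (isSpokeOf j ∘ τ) v (trans (cong (isSpokeOf j) τv) (≡ᵇ-refl j)))))

  module OfG = TypedChiS ℓ G τ (typedGraph-hasTypes types) 0 (count≡0⇒no-hub τ 0 #hubsOf0)
    (λ v j τv _ → count≡1⇒hub τ j (spoke⇒one-hub {v} τv))
    (count-positive⇒∃ (isHub ∘ τ) (subst (1 ≤_) (sym #isHub≡) (s≤s z≤n)))
    (≤-trans (n≤1+n ℓ) (≤-trans (≤-reflexive (sym #isPad≡)) (count-isPad≤count-inY-except τ 0)))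
    (≤-trans (+-monoʳ-≤ ℓ (#spokesOf≤ 0)) (≤-trans (n≤1+n _) (≤-reflexive (sym #isBase≡))))

  χ : ℕ
  χ = OfG.χ

  #vertices : ∀ i → count {length types} (λ _ → true) ≡ # (inXY i) + # (isSpokeOf i)
  #vertices i = count-+ (λ _ → true) (inXY i ∘ τ) (isSpokeOf i ∘ τ) (λ v → sym (fromBool-inXY+spokes i (τ v)))

  #XY-shift : ∀ i → # (inXY 0) ≡ # (inXY i) + # (isSpokeOf i)
  #XY-shift i = begin
    # (inXY 0)                        ≡⟨ +-identityʳ _ ⟨
    # (inXY 0) + 0                    ≡⟨ cong (# (inXY 0) +_) #spokesOf0 ⟨
    # (inXY 0) + # (isSpokeOf 0)      ≡⟨ #vertices 0 ⟨
    count {length types} (λ _ → true) ≡⟨ #vertices i ⟩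
    # (inXY i) + # (isSpokeOf i)      ∎
    where open ≡-Reasoning

  Drop : Fin (length types) → ℕ → Set
  Drop u d = Σ ℕ λ χ′ → IsChiS (seq1ℓ2∞ ℓ) (deleteVertex G u) χ′ × χ ≡ χ′ + d

  -- i is the index of u if u is a hub, and 0 otherwise.

  module Deletion (u : Fin (length types)) (i : ℕ)
    (no-hub-i : ∀ v → τ (punchIn u v) ≢ hub i)
    (u-not-other-hub : ∀ j → j ≢ i → isHubOf j (τ u) ≡ false)
    (u-not-spoke-i : isSpokeOf i (τ u) ≡ false) where

    τ′ : Fin (pred (length types)) → VertexType
    τ′ = τ ∘ punchIn u

    #′_ : (VertexType → Bool) → ℕ
    #′ f = count (f ∘ τ′)

    #′≥ : ∀ f {m} → suc m ≤ # f → m ≤ #′ f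
    #′≥ f m<#f = s≤s⁻¹ (≤-trans m<#f (count≤suc-count-punchIn (f ∘ τ) u))

    hub-of-spoke′ : ∀ v j → τ′ v ≡ spoke j → j ≢ i → Σ (Fin _) λ h → τ′ h ≡ hub j
    hub-of-spoke′ v j τ′v j≢i =
      count≡1⇒hub τ′ j (trans (count-punchIn-false (isHubOf j ∘ τ) u (u-not-other-hub j j≢i))
                               (spoke⇒one-hub {punchIn u v} τ′v))

    ℓ≤#outer′ : ℓ ≤ #′ (inY-except i)
    ℓ≤#outer′ = ≤-trans (#′≥ isPad (≤-reflexive (sym #isPad≡))) (count-isPad≤count-inY-except τ′ i)

    some-hub′ : Σ (Fin _) λ h → isHub (τ′ h) ≡ true
    some-hub′ = count-positive⇒∃ (isHub ∘ τ′) (#′≥ isHub (≤-trans (s≤s (s≤s z≤n)) (≤-reflexive (sym #isHub≡))))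

    base-large′ : ℓ + #′ (isSpokeOf i) ≤ #′ isBase
    base-large′ = ≤-trans (+-monoʳ-≤ ℓ (≤-trans (count-punchIn-≤ (isSpokeOf i ∘ τ) u) (#spokesOf≤ i)))
                          (#′≥ isBase (≤-reflexive (sym #isBase≡)))

    open TypedChiS ℓ (deleteVertex G u) τ′ (deleteVertex-hasTypes G τ u (typedGraph-hasTypes types)) i no-hub-i
      hub-of-spoke′ some-hub′ ℓ≤#outer′ base-large′
      renaming (χ to χ′) using (χS; χ+ℓ≡#XY)

    u∈XY : fromBool (inXY i (τ u)) ≡ 1
    u∈XY = trans (sym (+-identityʳ _)) (trans (cong (λ b → fromBool (inXY i (τ u)) + fromBool b) (sym u-not-spoke-i))
                                              (fromBool-inXY+spokes i (τ u)))

    drop : Drop u (suc (# (isSpokeOf i)))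
    drop = χ′ , χS , +-cancelʳ-≡ ℓ χ (χ′ + suc (# (isSpokeOf i))) (begin
      χ + ℓ                                           ≡⟨ OfG.χ+ℓ≡#XY ⟩
      # (inXY 0)                                      ≡⟨ #XY-shift i ⟩
      # (inXY i) + # (isSpokeOf i)                    ≡⟨ cong (_+ # (isSpokeOf i)) (count-punchIn (inXY i ∘ τ) u) ⟨
      #′ (inXY i) + fromBool (inXY i (τ u)) + # (isSpokeOf i)
                                                      ≡⟨ cong₂ (λ x y → x + y + # (isSpokeOf i)) (sym χ+ℓ≡#XY) u∈XY ⟩
      χ′ + ℓ + 1 + # (isSpokeOf i)                    ≡⟨ solve 3 (λ c l s → c :+ l :+ con 1 :+ s := c :+ (con 1 :+ s) :+ l) refl
                                                                 χ′ ℓ (# (isSpokeOf i)) ⟩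
      χ′ + suc (# (isSpokeOf i)) + ℓ                  ∎)
      where open ≡-Reasoning
            open +-*-Solver

  drop-nonHub : ∀ u → (∀ j → isHubOf j (τ u) ≡ false) → Drop u 1
  drop-nonHub u not-hub = subst (Drop u ∘ suc) #spokesOf0
    (Deletion.drop u 0 (λ v → count≡0⇒no-hub τ 0 #hubsOf0 (punchIn u v)) (λ j _ → not-hub j)
                       (count≡0⇒false (isSpokeOf 0 ∘ τ) u #spokesOf0))

  drop-hub : ∀ u j → τ u ≡ hub j → Drop u (suc (# (isSpokeOf j)))
  drop-hub u j τu = Deletion.drop u j (count≡0⇒no-hub τ′ j none-left) other-hub (cong (isSpokeOf j) τu)
    where
    τ′ = τ ∘ punchIn u
    u-hub : isHubOf j (τ u) ≡ true
    u-hub = trans (cong (isHubOf j) τu) (≡ᵇ-refl j)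
    none-left : count (isHubOf j ∘ τ′) ≡ 0
    none-left = +-cancelʳ-≡ 1 _ 0 (begin
      count (isHubOf j ∘ τ′) + 1                        ≡⟨ cong (λ b → count (isHubOf j ∘ τ′) + fromBool b) u-hub ⟨
      count (isHubOf j ∘ τ′) + fromBool (isHubOf j (τ u)) ≡⟨ count-punchIn (isHubOf j ∘ τ) u ⟩
      # (isHubOf j)                                     ≡⟨ proj₁ (one-hub j (inj₁ (count-positive (isHubOf j ∘ τ) u u-hub))) ⟩
      1                                                 ∎)
      where open ≡-Reasoning
    other-hub : ∀ k → k ≢ j → isHubOf k (τ u) ≡ false
    other-hub k k≢j = trans (cong (isHubOf k) τu) (≢⇒≡ᵇ-false j k (k≢j ∘ sym))

  suc-pred-entry : ∀ {x} → x ∈ a ∷ as → suc (pred x) ≡ x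
  suc-pred-entry {x} x∈ = suc-pred x {{>-nonZero (<⇒≤ (All.lookup a∷as>1 x∈))}}

  L⊆a∷as : ∀ {x} → x ∈ L → x ∈ a ∷ as
  L⊆a∷as (here x≡a) = here x≡a
  L⊆a∷as (there x∈) = x∈

  drop-value : ∀ u → Σ ℕ λ d → Drop u d × 1 ≤ d × (d ≡ 1 ⊎ d ∈ a ∷ as)
  drop-value u with τ u in τu
  ... | base    = 1 , drop-nonHub u (λ j → cong (isHubOf j) τu) , ≤-refl , inj₁ refl
  ... | spoke _ = 1 , drop-nonHub u (λ j → cong (isHubOf j) τu) , ≤-refl , inj₁ refl
  ... | pad     = 1 , drop-nonHub u (λ j → cong (isHubOf j) τu) , ≤-refl , inj₁ refl
  ... | hub j with one-hub j (inj₁ (count-positive (isHubOf j ∘ τ) u (trans (cong (isHubOf j) τu) (≡ᵇ-refl j))))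
  ...   | _ , x , x∈L , #spokes≡ =
    x , subst (Drop u) (trans (cong suc #spokes≡) (suc-pred-entry x∈a∷as)) (drop-hub u j τu) ,
    <⇒≤ (All.lookup a∷as>1 x∈a∷as) , inj₂ x∈a∷as
    where x∈a∷as = L⊆a∷as x∈L

  Drop-χS : ∀ u {d k k′} → Drop u d → IsChiS (seq1ℓ2∞ ℓ) G k → IsChiS (seq1ℓ2∞ ℓ) (deleteVertex G u) k′ →
            k ≡ k′ + d
  Drop-χS u {d} {k} {k′} (χ′ , χ′S , χ≡) χk χk′ = begin
    k       ≡⟨ IsChiS-unique {s = seq1ℓ2∞ ℓ} {H = G} χk OfG.χS ⟩
    χ       ≡⟨ χ≡ ⟩
    χ′ + d  ≡⟨ cong (_+ d) (IsChiS-unique {s = seq1ℓ2∞ ℓ} {H = deleteVertex G u} χ′S χk′) ⟩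
    k′ + d  ∎
    where open ≡-Reasoning

  critical : IsChiSCritical (seq1ℓ2∞ ℓ) G
  critical u k k′ χk χk′ with drop-value u
  ... | d , drop , 1≤d , _ = subst (k′ <_) (sym (Drop-χS u drop χk χk′)) (m<m+n k′ 1≤d)

  Δ-characterisation : ∀ d → InDelta (seq1ℓ2∞ ℓ) G d ⇔ ((d ≡ 1) ⊎ d ∈ a ∷ as)
  Δ-characterisation d = mk⇔ to from
    where
    toDelta : ∀ u {d} → Drop u d → InDelta (seq1ℓ2∞ ℓ) G d
    toDelta u {d} (χ′ , χ′S , χ≡) = u , χ , χ′ , OfG.χS , χ′S , sym (trans (cong (_∸ χ′) χ≡) (m+n∸m≡n χ′ d))
    to : InDelta (seq1ℓ2∞ ℓ) G d → (d ≡ 1) ⊎ d ∈ a ∷ as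
    to (u , k , k′ , χk , χk′ , d≡k∸k′) with drop-value u
    ... | e , drop , _ , e-value = subst (λ x → (x ≡ 1) ⊎ x ∈ a ∷ as) (sym d≡e) e-value
      where
      d≡e : d ≡ e
      d≡e = trans d≡k∸k′ (trans (cong (_∸ k′) (Drop-χS u drop χk χk′)) (m+n∸m≡n k′ e))
    from : (d ≡ 1) ⊎ d ∈ a ∷ as → InDelta (seq1ℓ2∞ ℓ) G d
    from (inj₁ refl) with count-positive⇒∃ (isBase ∘ τ) (subst (1 ≤_) (sym #isBase≡) (s≤s z≤n))
    ... | u , τu = toDelta u (drop-nonHub u λ j → cong (isHubOf j) (isBase⇒≡base (τ u) τu))
    from (inj₂ d∈) with hubsAndSpokes-∈ L 1 (there d∈)
    ... | j , _ , one with counts one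
    ...   | #hubsOfj≡1 , #spokes≡ with count≡1⇒hub τ j #hubsOfj≡1
    ...     | u , τu = toDelta u (subst (Drop u) (trans (cong suc #spokes≡) (suc-pred-entry d∈)) (drop-hub u j τu))

-- The construction does not need ℓ ≥ 1.

mainTheorem3 : (ℓ : ℕ) → 1 ≤ ℓ → (a : ℕ) → (as : List ℕ) → All (λ x → 1 < x) (a ∷ as) →
    Σ ℕ λ n → Σ (Graph n) λ G →
      IsChiSCritical (seq1ℓ2∞ ℓ) G ×
      (∀ d → InDelta (seq1ℓ2∞ ℓ) G d ⇔ ((d ≡ 1) ⊎ d ∈ (a ∷ as)))
mainTheorem3 ℓ _ a as a∷as>1 = length types , G , critical , Δ-characterisation
  where open Construction ℓ a as a∷as>1
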